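{- For a weak composition $a$ of length $n$, $$\mathfrak{F}_a=\sum_{\substack{b\unrhd a\\ \mathrm{flat}(b)\text{ refines }\mathrm{flat}(a)}}\mathfrak{M}_b,$$ where $b$ ranges over weak compositions of length $n$.
   Context: A weak composition of length $n$ is a sequence $a=(a_1,\dots,a_n)$ of nonnegative integers; $\mathrm{flat}(a)$ is the composition obtained by deleting zero entries. A composition $\beta$ refines a composition $\alpha$ if $\alpha$ is obtained from $\beta$ by summing consecutive blocks of parts. For weak compositions $a,b$ of length $n$, $b\ge a$ (dominance) means $b_1+\dots+b_i\ge a_1+\dots+a_i$ for all $i$. Say $b$ strongly dominates $a$, written $b\unrhd a$, if $b\ge a$ and every weak composition $c$ of length $n$ with $c\ge a$ and $\mathrm{flat}(c)=\mathrm{flat}(b)$ satisfies $c\ge b$. Monomial slide polynomial: $\mathfrak{M}_a=\sum x^{b}$ over weak compositions $b$ of length $n$ with $b\ge a$ and $\mathrm{flat}(b)=\mathrm{flat}(a)$. Fundamental slide polynomial: $\mathfrak{F}_a=\sum x^{b}$ over weak compositions $b$ of length $n$ with $b\ge a$ and $\mathrm{flat}(b)$ refining $\mathrm{flat}(a)$. Here $x^b=x_1^{b_1}\cdots x_n^{b_n}$. -}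

module Defs where

open import Data.Nat using (ℕ; zero; suc; _≤_)
open import Data.Fin using (Fin; toℕ)
open import Data.List using (List; []; _∷_; take; map; concat)
open import Data.Nat.ListAction using (sum)
open import Data.List.NonEmpty using (List⁺; toList)
open import Data.Vec using (Vec) renaming (toList to vtoList)
open import Data.Product using (Σ; _×_)
open import Relation.Binary.PropositionalEquality using (_≡_)

WeakComp : ℕ → Set
WeakComp n = Vec ℕ n

Comp : Set
Comp = List ℕ

flatL : List ℕ → Comp
flatL [] = []
flatL (zero ∷ xs) = flatL xs
flatL (suc k ∷ xs) = suc k ∷ flatL xs

flat : ∀ {n} → WeakComp n → Comp
flat a = flatL (vtoList a)

Refines : Comp → Comp → Set
Refines β α = Σ (List (List⁺ ℕ)) λ blocks →
  (concat (map toList blocks) ≡ β) × (map (λ B → sum (toList B)) blocks ≡ α)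

_≥D_ : ∀ {n} → WeakComp n → WeakComp n → Set
_≥D_ {n} b a = (i : Fin n) →
  sum (take (suc (toℕ i)) (vtoList a)) ≤ sum (take (suc (toℕ i)) (vtoList b))

_⊵_ : ∀ {n} → WeakComp n → WeakComp n → Set
_⊵_ {n} b a = (b ≥D a) ×
  ((c : WeakComp n) → c ≥D a → flat c ≡ flat b → c ≥D b)

-- The monomial x^c occurs in the monomial slide polynomial 𝔐_a
-- (all occurring monomials have coefficient 1, since distinct b give distinct x^b).
InMonomialSlide : ∀ {n} → WeakComp n → WeakComp n → Set
InMonomialSlide a c = (c ≥D a) × (flat c ≡ flat a)

-- The monomial x^c occurs (with coefficient 1) in the fundamental slide polynomial 𝔉_a.
InFundamentalSlide : ∀ {n} → WeakComp n → WeakComp n → Set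
InFundamentalSlide a c = (c ≥D a) × Refines (flat c) (flat a)

RHSIndex : ∀ {n} → WeakComp n → WeakComp n → Set
RHSIndex a b = (b ⊵ a) × Refines (flat b) (flat a)

module Submission where

open import Defs
open import Data.Bool using (Bool; true; false)
open import Data.Empty using (⊥-elim)
open import Data.Fin using (toℕ) renaming (zero to fzero; suc to fsuc)
open import Data.Fin.Properties using (all?)
open import Data.List using (List; []; _∷_; take; map; _++_; length)
open import Data.List.Membership.Propositional using (_∈_)
open import Data.List.Membership.Propositional.Properties using (∈-map⁺; ∈-++⁺ˡ; ∈-++⁺ʳ)
open import Data.List.Properties using (take-[])
open import Data.List.Relation.Unary.All using (All; []; _∷_)
open import Data.List.Relation.Unary.Any using (here; there)
open import Data.Nat using (ℕ; zero; suc; _+_; _≤_; _<_; z≤n; s≤s; _⊓_; _<ᵇ_; _≤?_; _≟_)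
open import Data.Nat.ListAction using (sum)
open import Data.Nat.Properties
open import Data.Product using (Σ; _×_; _,_; proj₁; proj₂)
open import Data.Vec using (Vec; []; _∷_) renaming (toList to vtoList)
open import Relation.Binary.PropositionalEquality
  using (_≡_; refl; sym; trans; cong; cong₂; subst; subst₂; module ≡-Reasoning)
open import Relation.Nullary using (¬_; Dec; yes; no)
open import Relation.Unary using (Decidable)

-- Every monomial x^c of 𝔐_b with b ⊵ a lies in 𝔉_a, by transitivity of
-- dominance.  Conversely, let x^c lie in 𝔉_a.  Among all weak compositions c′ ≥ a with
-- flat c′ = flat c there is a dominance-least one, b; it strongly dominates a by
-- construction and c ≥ b, so x^c occurs in 𝔐_b.  Two strongly dominating b, b′ with the
-- same flattening dominate each other, hence coincide.  The least element exists since
-- such c′ are determined by their supports, and these form a finite family closed under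
-- the meet taking pointwise minima of prefix counts of ones.

bit : Bool → ℕ
bit true  = 1
bit false = 0

prefixCount : ∀ {n} → ℕ → Vec Bool n → ℕ
prefixCount zero    s       = 0
prefixCount (suc i) []      = 0
prefixCount (suc i) (x ∷ s) = bit x + prefixCount i s

count : ∀ {n} → Vec Bool n → ℕ
count {n} = prefixCount n

_≼_ : ∀ {n} → Vec Bool n → Vec Bool n → Set
s ≼ t = ∀ i → prefixCount i s ≤ prefixCount i t

≼-trans : ∀ {n} {s t u : Vec Bool n} → s ≼ t → t ≼ u → s ≼ u
≼-trans p q i = ≤-trans (p i) (q i)

-- meetFrom o₁ o₂ continues the meet of two supports whose prefixes so far contain
-- o₁ and o₂ ones: it places a one exactly where the running minimum grows.
meetFrom : ∀ {n} → ℕ → ℕ → Vec Bool n → Vec Bool n → Vec Bool n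
meetFrom o₁ o₂ []      []      = []
meetFrom o₁ o₂ (x ∷ s) (y ∷ t) =
  (o₁ ⊓ o₂ <ᵇ o₁′ ⊓ o₂′) ∷ meetFrom o₁′ o₂′ s t
  where
  o₁′ = o₁ + bit x
  o₂′ = o₂ + bit y

meet : ∀ {n} → Vec Bool n → Vec Bool n → Vec Bool n
meet = meetFrom 0 0

m+bit[m<ᵇn]≡n : ∀ m n → m ≤ n → n ≤ suc m → m + bit (m <ᵇ n) ≡ n
m+bit[m<ᵇn]≡n zero    zero          _       _             = refl
m+bit[m<ᵇn]≡n zero    (suc zero)    _       _             = refl
m+bit[m<ᵇn]≡n (suc m) (suc n)       (s≤s p) (s≤s q)       = cong suc (m+bit[m<ᵇn]≡n m n p q)
m+bit[m<ᵇn]≡n zero    (suc (suc n)) _       (s≤s ())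

m+bit≤1+m : ∀ m x → m + bit x ≤ suc m
m+bit≤1+m m true  = ≤-reflexive (+-comm m 1)
m+bit≤1+m m false = subst (_≤ suc m) (sym (+-identityʳ m)) (n≤1+n m)

prefixCount-meetFrom : ∀ {n} i o₁ o₂ (s t : Vec Bool n) →
  o₁ ⊓ o₂ + prefixCount i (meetFrom o₁ o₂ s t) ≡ (o₁ + prefixCount i s) ⊓ (o₂ + prefixCount i t)
prefixCount-meetFrom zero o₁ o₂ s t =
  trans (+-identityʳ _) (sym (cong₂ _⊓_ (+-identityʳ o₁) (+-identityʳ o₂)))
prefixCount-meetFrom (suc i) o₁ o₂ [] [] =
  trans (+-identityʳ _) (sym (cong₂ _⊓_ (+-identityʳ o₁) (+-identityʳ o₂)))
prefixCount-meetFrom (suc i) o₁ o₂ (x ∷ s) (y ∷ t) = begin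
  m + (bit (m <ᵇ m′) + prefixCount i (meetFrom o₁′ o₂′ s t))
    ≡⟨ +-assoc m _ _ ⟨
  m + bit (m <ᵇ m′) + prefixCount i (meetFrom o₁′ o₂′ s t)
    ≡⟨ cong (_+ prefixCount i (meetFrom o₁′ o₂′ s t)) (m+bit[m<ᵇn]≡n m m′ m≤m′ m′≤1+m) ⟩
  m′ + prefixCount i (meetFrom o₁′ o₂′ s t)
    ≡⟨ prefixCount-meetFrom i o₁′ o₂′ s t ⟩
  (o₁′ + prefixCount i s) ⊓ (o₂′ + prefixCount i t)
    ≡⟨ cong₂ _⊓_ (+-assoc o₁ (bit x) _) (+-assoc o₂ (bit y) _) ⟩
  (o₁ + (bit x + prefixCount i s)) ⊓ (o₂ + (bit y + prefixCount i t)) ∎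
  where
  open ≡-Reasoning
  o₁′ = o₁ + bit x
  o₂′ = o₂ + bit y
  m   = o₁ ⊓ o₂
  m′  = o₁′ ⊓ o₂′
  m≤m′ : m ≤ m′
  m≤m′ = ⊓-mono-≤ (m≤m+n o₁ (bit x)) (m≤m+n o₂ (bit y))
  m′≤1+m : m′ ≤ suc m
  m′≤1+m = ⊓-mono-≤ (m+bit≤1+m o₁ x) (m+bit≤1+m o₂ y)

prefixCount-meet : ∀ {n} i (s t : Vec Bool n) →
  prefixCount i (meet s t) ≡ prefixCount i s ⊓ prefixCount i t
prefixCount-meet i = prefixCount-meetFrom i 0 0

meet-≼ˡ : ∀ {n} (s t : Vec Bool n) → meet s t ≼ s
meet-≼ˡ s t i = subst (_≤ _) (sym (prefixCount-meet i s t)) (m⊓n≤m _ _)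

meet-≼ʳ : ∀ {n} (s t : Vec Bool n) → meet s t ≼ t
meet-≼ʳ s t i = subst (_≤ _) (sym (prefixCount-meet i s t)) (m⊓n≤n _ _)

allSupports : ∀ n → List (Vec Bool n)
allSupports zero    = [] ∷ []
allSupports (suc n) = map (true ∷_) (allSupports n) ++ map (false ∷_) (allSupports n)

∈-allSupports : ∀ {n} (s : Vec Bool n) → s ∈ allSupports n
∈-allSupports []          = here refl
∈-allSupports (true ∷ s)  = ∈-++⁺ˡ (∈-map⁺ (true ∷_) (∈-allSupports s))
∈-allSupports {suc n} (false ∷ s) =
  ∈-++⁺ʳ (map (true ∷_) (allSupports n)) (∈-map⁺ (false ∷_) (∈-allSupports s))

module MeetClosed {n : ℕ} {P : Vec Bool n → Set} (P? : Decidable P)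
                  (P-meet : ∀ {s t} → P s → P t → P (meet s t)) where

  meetAll : List (Vec Bool n) → Vec Bool n → Vec Bool n
  meetAll []       acc = acc
  meetAll (s ∷ ss) acc with P? s
  ... | yes _ = meetAll ss (meet acc s)
  ... | no  _ = meetAll ss acc

  meetAll-satisfies : ∀ ss {acc} → P acc → P (meetAll ss acc)
  meetAll-satisfies []       p = p
  meetAll-satisfies (s ∷ ss) p with P? s
  ... | yes ps = meetAll-satisfies ss (P-meet p ps)
  ... | no  _  = meetAll-satisfies ss p

  meetAll-≼-acc : ∀ ss acc → meetAll ss acc ≼ acc
  meetAll-≼-acc []       acc i = ≤-refl
  meetAll-≼-acc (s ∷ ss) acc with P? s
  ... | yes _ = ≼-trans (meetAll-≼-acc ss (meet acc s)) (meet-≼ˡ acc s)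
  ... | no  _ = meetAll-≼-acc ss acc

  meetAll-≼-∈ : ∀ ss acc {t} → t ∈ ss → P t → meetAll ss acc ≼ t
  meetAll-≼-∈ (s ∷ ss) acc t∈ pt with P? s
  meetAll-≼-∈ (s ∷ ss) acc (here refl) pt | yes _ =
    ≼-trans (meetAll-≼-acc ss (meet acc s)) (meet-≼ʳ acc s)
  meetAll-≼-∈ (s ∷ ss) acc (there t∈) pt | yes _ = meetAll-≼-∈ ss (meet acc s) t∈ pt
  meetAll-≼-∈ (s ∷ ss) acc (here refl) pt | no ¬ps = ⊥-elim (¬ps pt)
  meetAll-≼-∈ (s ∷ ss) acc (there t∈) pt | no _ = meetAll-≼-∈ ss acc t∈ pt

  least : ∀ {s} → P s → Σ (Vec Bool n) λ m → P m × (∀ t → P t → m ≼ t)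
  least {s} ps = meetAll (allSupports n) s
               , meetAll-satisfies (allSupports n) ps
               , λ t → meetAll-≼-∈ (allSupports n) s (∈-allSupports t)

place : ∀ {n} → Comp → Vec Bool n → WeakComp n
place p       []          = []
place p       (false ∷ s) = 0 ∷ place p s
place []      (true ∷ s)  = 0 ∷ place [] s
place (q ∷ p) (true ∷ s)  = q ∷ place p s

support : ∀ {n} → WeakComp n → Vec Bool n
support []          = []
support (zero ∷ b)  = false ∷ support b
support (suc _ ∷ b) = true ∷ support b

sum-take-[] : ∀ j → sum (take j []) ≡ 0
sum-take-[] j = cong sum (take-[] j)

sum-take-place : ∀ {n} i p (s : Vec Bool n) →
  sum (take i (vtoList (place p s))) ≡ sum (take (prefixCount i s) p)
sum-take-place zero    p       s           = refl
sum-take-place (suc i) p       []          = refl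
sum-take-place (suc i) p       (false ∷ s) = sum-take-place i p s
sum-take-place (suc i) []      (true ∷ s)  =
  trans (sum-take-place i [] s) (sum-take-[] (prefixCount i s))
sum-take-place (suc i) (q ∷ p) (true ∷ s)  = cong (q +_) (sum-take-place i p s)

sum-take-mono : ∀ p {j k} → j ≤ k → sum (take j p) ≤ sum (take k p)
sum-take-mono []      {j} {k} _ = ≤-reflexive (trans (sum-take-[] j) (sym (sum-take-[] k)))
sum-take-mono (q ∷ p) z≤n       = z≤n
sum-take-mono (q ∷ p) (s≤s j≤k) = +-monoʳ-≤ q (sum-take-mono p j≤k)

place-mono : ∀ {n} p {s t : Vec Bool n} → s ≼ t → place p t ≥D place p s
place-mono p {s} {t} s≼t i = subst₂ _≤_
  (sym (sum-take-place (suc (toℕ i)) p s)) (sym (sum-take-place (suc (toℕ i)) p t))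
  (sum-take-mono p (s≼t (suc (toℕ i))))

flatL-positive : ∀ l → All (0 <_) (flatL l)
flatL-positive []          = []
flatL-positive (zero ∷ l)  = flatL-positive l
flatL-positive (suc _ ∷ l) = s≤s z≤n ∷ flatL-positive l

flat-place : ∀ {n} p (s : Vec Bool n) → All (0 <_) p → count s ≡ length p → flat (place p s) ≡ p
flat-place []          []          _                   _  = refl
flat-place p           (false ∷ s) p>0                 eq = flat-place p s p>0 eq
flat-place (suc q ∷ p) (true ∷ s)  (s≤s z≤n ∷ p>0)     eq =
  cong (suc q ∷_) (flat-place p s p>0 (suc-injective eq))

place-flat-support : ∀ {n} (b : WeakComp n) → place (flat b) (support b) ≡ b
place-flat-support []          = refl
place-flat-support (zero ∷ b)  = cong (0 ∷_) (place-flat-support b)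
place-flat-support (suc q ∷ b) = cong (suc q ∷_) (place-flat-support b)

count-support : ∀ {n} (b : WeakComp n) → count (support b) ≡ length (flat b)
count-support []          = refl
count-support (zero ∷ b)  = count-support b
count-support (suc _ ∷ b) = cong suc (count-support b)

≥D? : ∀ {n} (b a : WeakComp n) → Dec (b ≥D a)
≥D? b a = all? (λ i → _ ≤? _)

≥D-trans : ∀ {n} {x y z : WeakComp n} → x ≥D y → y ≥D z → x ≥D z
≥D-trans x≥y y≥z i = ≤-trans (y≥z i) (x≥y i)

≥D-tail : ∀ {n x} {xs ys : WeakComp n} → (x ∷ xs) ≥D (x ∷ ys) → xs ≥D ys
≥D-tail {x = x} x∷xs≥x∷ys i = +-cancelˡ-≤ x _ _ (x∷xs≥x∷ys (fsuc i))

≥D-antisym : ∀ {n} (x y : WeakComp n) → x ≥D y → y ≥D x → x ≡ y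
≥D-antisym []       []       _   _   = refl
≥D-antisym (x ∷ xs) (y ∷ ys) x≥y y≥x with ≤-antisym (+-cancelʳ-≤ 0 x y (y≥x fzero))
                                                    (+-cancelʳ-≤ 0 y x (x≥y fzero))
... | refl = cong (x ∷_) (≥D-antisym xs ys (≥D-tail x≥y) (≥D-tail y≥x))

module LeastDominating {n : ℕ} (p : Comp) (a : WeakComp n) where

  Admissible : Vec Bool n → Set
  Admissible s = (count s ≡ length p) × (place p s ≥D a)

  admissible? : Decidable Admissible
  admissible? s with count s ≟ length p | ≥D? (place p s) a
  ... | yes e  | yes d  = yes (e , d)
  ... | no ¬e  | _      = no (λ adm → ¬e (proj₁ adm))
  ... | _      | no ¬d  = no (λ adm → ¬d (proj₂ adm))

  -- The partial sums of place p (meet s t) are the minima of those of place p s and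
  -- place p t, because j ↦ sum (take j p) is monotone.
  place-meet-≥D : ∀ {s t} → place p s ≥D a → place p t ≥D a → place p (meet s t) ≥D a
  place-meet-≥D {s} {t} s≥a t≥a i = begin
    sum (take j (vtoList a))                                  ≤⟨ ⊓-glb (s≥a i) (t≥a i) ⟩
    sum (take j (vtoList (place p s))) ⊓ sum (take j (vtoList (place p t)))
      ≡⟨ cong₂ _⊓_ (sum-take-place j p s) (sum-take-place j p t) ⟩
    sum (take (prefixCount j s) p) ⊓ sum (take (prefixCount j t) p)
      ≡⟨ mono-≤-distrib-⊓ (sum-take-mono p) (prefixCount j s) (prefixCount j t) ⟨
    sum (take (prefixCount j s ⊓ prefixCount j t) p)
      ≡⟨ cong (λ k → sum (take k p)) (prefixCount-meet j s t) ⟨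
    sum (take (prefixCount j (meet s t)) p)
      ≡⟨ sum-take-place j p (meet s t) ⟨
    sum (take j (vtoList (place p (meet s t)))) ∎
    where
    open ≤-Reasoning
    j = suc (toℕ i)

  admissible-meet : ∀ {s t} → Admissible s → Admissible t → Admissible (meet s t)
  admissible-meet {s} {t} (cs , s≥a) (ct , t≥a) =
    trans (prefixCount-meet n s t) (trans (cong₂ _⊓_ cs ct) (⊓-idem (length p))) ,
    place-meet-≥D {s} {t} s≥a t≥a

  place-support : (c : WeakComp n) → flat c ≡ p → place p (support c) ≡ c
  place-support c flat-c≡p = subst (λ q → place q (support c) ≡ c) flat-c≡p (place-flat-support c)

  support-admissible : (c : WeakComp n) → c ≥D a → flat c ≡ p → Admissible (support c)
  support-admissible c c≥a flat-c≡p =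
    trans (count-support c) (cong length flat-c≡p) ,
    subst (_≥D a) (sym (place-support c flat-c≡p)) c≥a

least-dominating : ∀ {n} (a c : WeakComp n) → c ≥D a →
  Σ (WeakComp n) λ b → flat b ≡ flat c × b ≥D a ×
    (∀ c′ → c′ ≥D a → flat c′ ≡ flat c → c′ ≥D b)
least-dominating {n} a c c≥a = from-minimum (least (support-admissible c c≥a refl))
  where
  p = flat c
  open LeastDominating p a
  open MeetClosed admissible? admissible-meet
  from-minimum : Σ (Vec Bool n) (λ m → Admissible m × (∀ t → Admissible t → m ≼ t)) →
    Σ (WeakComp n) λ b → flat b ≡ p × b ≥D a × (∀ c′ → c′ ≥D a → flat c′ ≡ p → c′ ≥D b)
  from-minimum (m , (count-m , m≥a) , m-least) =
    place p m , flat-place p m (flatL-positive (vtoList c)) count-m , m≥a ,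
    λ c′ c′≥a flat-c′≡p → subst (_≥D place p m) (place-support c′ flat-c′≡p)
      (place-mono p (m-least (support c′) (support-admissible c′ c′≥a flat-c′≡p)))

⊵-unique : ∀ {n} {a b b′ : WeakComp n} → b ⊵ a → b′ ⊵ a → flat b ≡ flat b′ → b ≡ b′
⊵-unique {b = b} {b′} (b≥a , b-least) (b′≥a , b′-least) flat-b≡flat-b′ =
  ≥D-antisym b b′ (b′-least b b≥a flat-b≡flat-b′) (b-least b′ b′≥a (sym flat-b≡flat-b′))

⊵-below : ∀ {n} {a c : WeakComp n} → c ≥D a →
  Σ (WeakComp n) λ b → b ⊵ a × flat b ≡ flat c × c ≥D b
⊵-below {a = a} {c} c≥a with least-dominating a c c≥a
... | b , flat-b≡flat-c , b≥a , b-least =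
  b , (b≥a , λ c′ c′≥a flat-c′≡flat-b → b-least c′ c′≥a (trans flat-c′≡flat-b flat-b≡flat-c)) ,
  flat-b≡flat-c , b-least c c≥a refl

monomialSlide⊆fundamentalSlide : ∀ {n} {a b c : WeakComp n} →
  RHSIndex a b → InMonomialSlide b c → InFundamentalSlide a c
monomialSlide⊆fundamentalSlide {a = a} {b} {c}
  ((b≥a , _) , flat-b-refines) (c≥b , flat-c≡flat-b) =
  ≥D-trans {x = c} {b} {a} c≥b b≥a ,
  subst (λ β → Refines β (flat a)) (sym flat-c≡flat-b) flat-b-refines

proposition3p7 : (n : ℕ) (a c : WeakComp n) →
    (InFundamentalSlide a c →
      Σ (WeakComp n) λ b → (RHSIndex a b × InMonomialSlide b c) ×
        ((b′ : WeakComp n) → RHSIndex a b′ → InMonomialSlide b′ c → b′ ≡ b))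
    × (¬ InFundamentalSlide a c →
      (b : WeakComp n) → RHSIndex a b → ¬ InMonomialSlide b c)
proposition3p7 n a c =
  unique-index ,
  λ c∉𝔉 b b∈ c∈𝔐 → c∉𝔉 (monomialSlide⊆fundamentalSlide {a = a} {b} {c} b∈ c∈𝔐)
  where
  unique-index : InFundamentalSlide a c →
    Σ (WeakComp n) λ b → (RHSIndex a b × InMonomialSlide b c) ×
      ((b′ : WeakComp n) → RHSIndex a b′ → InMonomialSlide b′ c → b′ ≡ b)
  unique-index (c≥a , flat-c-refines) = from-below (⊵-below {a = a} {c} c≥a)
    where
    from-below : Σ (WeakComp n) (λ b → b ⊵ a × flat b ≡ flat c × c ≥D b) →
      Σ (WeakComp n) λ b → (RHSIndex a b × InMonomialSlide b c) ×
        ((b′ : WeakComp n) → RHSIndex a b′ → InMonomialSlide b′ c → b′ ≡ b)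
    from-below (b , b⊵a , flat-b≡flat-c , c≥b) =
      b , ((b⊵a , subst (λ β → Refines β (flat a)) (sym flat-b≡flat-c) flat-c-refines) ,
           c≥b , sym flat-b≡flat-c) ,
      λ b′ (b′⊵a , _) (_ , flat-c≡flat-b′) →
        ⊵-unique {a = a} {b′} {b} b′⊵a b⊵a (trans (sym flat-c≡flat-b′) (sym flat-b≡flat-c))
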